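{- If $Q\in\mathsf{P}_\Sigma^*$ has equally many opening and closing parentheses and $Q^2$ is a substring of some balanced string, then $Q$ has a balanced cyclic rotation, i.e., $Q[i..|Q|)\,Q[0..i)$ is balanced for some $i\in[0..|Q|]$.
   Context: $\mathsf{P}_\Sigma=\{(_a,)_a:a\in\Sigma\}$ is the set of parentheses labeled by an alphabet $\Sigma$; $(_a$ are opening and $)_a$ closing parentheses. The set of balanced strings is the smallest subset of $\mathsf{P}_\Sigma^*$ containing the empty string, closed under concatenation, and containing $(_aX)_a$ for every balanced $X$ and $a\in\Sigma$. -}

module Defs where

open import Level using (Level)
open import Data.Nat using (ℕ; zero; suc)
open import Data.List using (List; []; _∷_; _++_; length)
open import Data.Product using (∃₂)
open import Relation.Binary.PropositionalEquality using (_≡_)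

data Paren {ℓ : Level} (Σ : Set ℓ) : Set ℓ where
  open⟨_⟩  : Σ → Paren Σ
  close⟨_⟩ : Σ → Paren Σ

data Balanced {ℓ : Level} {Σ : Set ℓ} : List (Paren Σ) → Set ℓ where
  bal-ε    : Balanced []
  bal-cat  : ∀ {X Y} → Balanced X → Balanced Y → Balanced (X ++ Y)
  bal-wrap : ∀ {X} (a : Σ) → Balanced X → Balanced (open⟨ a ⟩ ∷ X ++ close⟨ a ⟩ ∷ [])

#open : {ℓ : Level} {Σ : Set ℓ} → List (Paren Σ) → ℕ
#open [] = zero
#open (open⟨ _ ⟩ ∷ w) = suc (#open w)
#open (close⟨ _ ⟩ ∷ w) = #open w

#close : {ℓ : Level} {Σ : Set ℓ} → List (Paren Σ) → ℕ
#close [] = zero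
#close (open⟨ _ ⟩ ∷ w) = #close w
#close (close⟨ _ ⟩ ∷ w) = suc (#close w)

_IsSubstringOf_ : {ℓ : Level} {Σ : Set ℓ} → List (Paren Σ) → List (Paren Σ) → Set ℓ
u IsSubstringOf w = ∃₂ λ L R → L ++ u ++ R ≡ w

-- Read a word from left to right with a stack of pending labels: an opening
-- parenthesis pushes its label, a closing one must pop the same label, and the
-- balanced words are exactly those read from the empty stack back to it.  Let
-- the height of a word be #open − #close, and cut Q = x y at a prefix x of
-- least height.  Every prefix of the rotation y x then has height ≥ 0, and
-- height (y x) = height Q = 0.  The rotation occurs inside Q Q, hence inside a
-- balanced word, so it is read from some stack; since its heights never drop
-- below 0 that stack is never touched, and the reading of y x alone goes from
-- the empty stack back to the empty stack.
module Submission where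

open import Defs
open import Level using (Level)
open import Data.Nat using (ℕ; _≤_; suc)
open import Data.Integer using (ℤ; +_; -_; _+_; _⊖_; 0ℤ; 1ℤ; -1ℤ) renaming (_≤_ to _≤ᶻ_)
import Data.Integer.Properties as ℤ
open import Data.Integer.Tactic.RingSolver using (solve-∀)
open import Data.List using (List; []; _∷_; _++_; length; take; drop)
open import Data.List.Properties using (++-assoc; ++-identityʳ; ++-monoid; length-++-≤ˡ)
open import Data.List.Relation.Binary.Prefix.Heterogeneous using (Prefix; []; _∷_; _++ᵖ_)
open import Data.List.Relation.Binary.Prefix.Heterogeneous.Properties using (++⁺)
import Data.List.Relation.Binary.Pointwise as Pointwise
open import Data.List.Relation.Binary.Prefix.Propositional.Properties using (Prefix-as-∣ˡ)
open import Data.Product using (∃; ∃₂; _×_; _,_)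
open import Data.Sum using (_⊎_; inj₁; inj₂)
open import Relation.Binary.PropositionalEquality
open import Relation.Nullary using (yes; no)
import Algebra.Solver.Monoid as MonoidSolver

take-length-++ : ∀ {a} {B : Set a} (xs ys : List B) → take (length xs) (xs ++ ys) ≡ xs
take-length-++ []       ys = refl
take-length-++ (x ∷ xs) ys = cong (x ∷_) (take-length-++ xs ys)

drop-length-++ : ∀ {a} {B : Set a} (xs ys : List B) → drop (length xs) (xs ++ ys) ≡ ys
drop-length-++ []       ys = refl
drop-length-++ (x ∷ xs) ys = drop-length-++ xs ys

i≤i+j⇒0≤j : ∀ i j → i ≤ᶻ i + j → 0ℤ ≤ᶻ j
i≤i+j⇒0≤j i j i≤i+j =
  subst₂ _≤ᶻ_ (ℤ.+-inverseˡ i) (cancel i j) (ℤ.+-monoʳ-≤ (- i) i≤i+j)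
  where
  cancel : ∀ i j → - i + (i + j) ≡ j
  cancel = solve-∀

module _ {ℓ : Level} {A : Set ℓ} where

  Word : Set ℓ
  Word = List (Paren A)

  _≼_ : Word → Word → Set ℓ
  _≼_ = Prefix _≡_

  prefix-of-++ : ∀ {v} y {x} → v ≼ (y ++ x) → v ≼ y ⊎ ∃ λ u → v ≡ y ++ u × u ≼ x
  prefix-of-++ []      v≼x        = inj₂ (_ , refl , v≼x)
  prefix-of-++ (_ ∷ y) []         = inj₁ []
  prefix-of-++ (_ ∷ y) (refl ∷ v≼) with prefix-of-++ y v≼
  ... | inj₁ v≼y               = inj₁ (refl ∷ v≼y)
  ... | inj₂ (u , refl , u≼x) = inj₂ (u , refl , u≼x)

  substring-trans : ∀ {u v w : Word} → u IsSubstringOf v → v IsSubstringOf w → u IsSubstringOf w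
  substring-trans {u} (L₁ , R₁ , refl) (L₂ , R₂ , refl) =
    L₂ ++ L₁ , R₁ ++ R₂ ,
    solve 5 (λ L₂ L₁ u R₁ R₂ → (L₂ ⊕ L₁) ⊕ u ⊕ (R₁ ⊕ R₂) ⊜ L₂ ⊕ (L₁ ⊕ u ⊕ R₁) ⊕ R₂) refl L₂ L₁ u R₁ R₂
    where open MonoidSolver (++-monoid (Paren A))

  rotation-substring : ∀ (x y : Word) → (y ++ x) IsSubstringOf ((x ++ y) ++ (x ++ y))
  rotation-substring x y =
    x , y , solve 2 (λ x y → x ⊕ (y ⊕ x) ⊕ y ⊜ (x ⊕ y) ⊕ (x ⊕ y)) refl x y
    where open MonoidSolver (++-monoid (Paren A))

  step : Paren A → ℤ
  step open⟨ _ ⟩  = 1ℤ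
  step close⟨ _ ⟩ = -1ℤ

  height : Word → ℤ
  height []      = 0ℤ
  height (p ∷ w) = step p + height w

  height-++ : ∀ u v → height (u ++ v) ≡ height u + height v
  height-++ []      v = sym (ℤ.+-identityˡ (height v))
  height-++ (p ∷ u) v = trans (cong (_+_ (step p)) (height-++ u v)) (sym (ℤ.+-assoc (step p) _ _))

  height≡#open⊖#close : ∀ w → height w ≡ #open w ⊖ #close w
  height≡#open⊖#close []               = refl
  height≡#open⊖#close (open⟨ _ ⟩ ∷ w)  =
    trans (cong (_+_ 1ℤ) (height≡#open⊖#close w)) (ℤ.distribʳ-⊖-+-pos 1 (#open w) (#close w))
  height≡#open⊖#close (close⟨ _ ⟩ ∷ w) =
    trans (cong (_+_ -1ℤ) (height≡#open⊖#close w)) (ℤ.distribʳ-⊖-+-neg 0 (#open w) (#close w))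

  height-rotate : ∀ x y → height (y ++ x) ≡ height (x ++ y)
  height-rotate x y = begin
    height (y ++ x)      ≡⟨ height-++ y x ⟩
    height y + height x  ≡⟨ ℤ.+-comm (height y) (height x) ⟩
    height x + height y  ≡⟨ height-++ x y ⟨
    height (x ++ y)      ∎
    where open ≡-Reasoning

  NeverNegative : Word → Set ℓ
  NeverNegative w = ∀ v → v ≼ w → 0ℤ ≤ᶻ height v

  LowestPrefix : Word → Word → Set ℓ
  LowestPrefix x q = x ≼ q × (∀ u → u ≼ q → height x ≤ᶻ height u)

  lowest-prefix : ∀ q → ∃ λ x → LowestPrefix x q
  lowest-prefix []      = [] , [] , λ { [] [] → ℤ.≤-refl }
  lowest-prefix (p ∷ q) with lowest-prefix q
  ... | x , x≼q , x-lowest with height (p ∷ x) ℤ.≤? 0ℤ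
  ... | yes px≤0 = p ∷ x , refl ∷ x≼q , λ
    { [] []                → px≤0
    ; (_ ∷ u) (refl ∷ u≼q) → ℤ.+-monoʳ-≤ (step p) (x-lowest u u≼q)
    }
  ... | no px≰0  = [] , [] , λ
    { [] []                → ℤ.≤-refl
    ; (_ ∷ u) (refl ∷ u≼q) →
        ℤ.≤-trans (ℤ.<⇒≤ (ℤ.≰⇒> px≰0)) (ℤ.+-monoʳ-≤ (step p) (x-lowest u u≼q))
    }

  lowest-rotation-never-negative : ∀ x y → LowestPrefix x (x ++ y) → height (x ++ y) ≡ 0ℤ →
                                   NeverNegative (y ++ x)
  lowest-rotation-never-negative x y (_ , x-lowest) hQ v v≼yx with prefix-of-++ y v≼yx
  ... | inj₁ v≼y =
    i≤i+j⇒0≤j (height x) (height v)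
      (subst (height x ≤ᶻ_) (height-++ x v) (x-lowest (x ++ v) (++⁺ (Pointwise.refl refl) v≼y)))
  ... | inj₂ (u , refl , u≼x) = begin
    0ℤ                   ≡⟨ trans (sym hQ) (height-rotate y x) ⟩
    height (y ++ x)      ≡⟨ height-++ y x ⟩
    height y + height x  ≤⟨ ℤ.+-monoʳ-≤ (height y) (x-lowest u (u≼x ++ᵖ y)) ⟩
    height y + height u  ≡⟨ height-++ y u ⟨
    height (y ++ u)      ∎
    where open ℤ.≤-Reasoning

  data Run : List A → Word → List A → Set ℓ where
    done : ∀ {s} → Run s [] s
    push : ∀ {s a w t} → Run (a ∷ s) w t → Run s (open⟨ a ⟩ ∷ w) t
    pop  : ∀ {s a w t} → Run s w t → Run (a ∷ s) (close⟨ a ⟩ ∷ w) t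

  run-++ : ∀ {s t r} x {y} → Run s x t → Run t y r → Run s (x ++ y) r
  run-++ []      done     q = q
  run-++ (_ ∷ x) (push p) q = push (run-++ x p q)
  run-++ (_ ∷ x) (pop p)  q = pop (run-++ x p q)

  run-++⁻ : ∀ {s r} x {y} → Run s (x ++ y) r → ∃ λ t → Run s x t × Run t y r
  run-++⁻ []      p = _ , done , p
  run-++⁻ (_ ∷ x) (push p) with run-++⁻ x p
  ... | t , p₁ , p₂ = t , push p₁ , p₂
  run-++⁻ (_ ∷ x) (pop p) with run-++⁻ x p
  ... | t , p₁ , p₂ = t , pop p₁ , p₂

  balanced⇒run : ∀ {w} → Balanced w → ∀ s → Run s w s
  balanced⇒run bal-ε               s = done
  balanced⇒run (bal-cat {X} bX bY) s = run-++ X (balanced⇒run bX s) (balanced⇒run bY s)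
  balanced⇒run (bal-wrap {X} a bX) s = push (run-++ X (balanced⇒run bX (a ∷ s)) (pop done))

  balanced-substring-run : ∀ {u W} → Balanced W → u IsSubstringOf W → ∃₂ λ s t → Run s u t
  balanced-substring-run {u} bW (L , R , refl) with run-++⁻ L (balanced⇒run bW [])
  ... | s , _ , r with run-++⁻ u r
  ... | t , r′ , _ = s , t , r′

  -- Pending s u: u = B₀ (_aₙ B₁ ⋯ (_a₁ Bₙ with every Bᵢ balanced and
  -- s = a₁ ∷ ⋯ ∷ aₙ, the unmatched opening parentheses of u, innermost first.
  data Pending : List A → Word → Set ℓ where
    bottom : ∀ {u} → Balanced u → Pending [] u
    opened : ∀ {s u v} a → Pending s u → Balanced v → Pending (a ∷ s) (u ++ open⟨ a ⟩ ∷ v)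

  pending-++ : ∀ {s u b} → Pending s u → Balanced b → Pending s (u ++ b)
  pending-++ (bottom bu) bb = bottom (bal-cat bu bb)
  pending-++ {b = b} (opened {u = u} {v} a pu bv) bb =
    subst (Pending _) (sym (++-assoc u (open⟨ a ⟩ ∷ v) b)) (opened a pu (bal-cat bv bb))

  run-pending : ∀ {s w t u} → Run s w t → Pending s u → Pending t (u ++ w)
  run-pending {u = u} done pu = subst (Pending _) (sym (++-identityʳ u)) pu
  run-pending {w = open⟨ a ⟩ ∷ w} {u = u} (push r) pu =
    subst (Pending _) (++-assoc u (open⟨ a ⟩ ∷ []) w) (run-pending r (opened a pu bal-ε))
  run-pending {w = close⟨ a ⟩ ∷ w} (pop r) (opened {u = u} {v} a pu bv) =
    subst (Pending _) close-assoc (run-pending r (pending-++ pu (bal-wrap a bv)))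
    where
    close-assoc : (u ++ open⟨ a ⟩ ∷ v ++ close⟨ a ⟩ ∷ []) ++ w ≡ (u ++ open⟨ a ⟩ ∷ v) ++ close⟨ a ⟩ ∷ w
    close-assoc = solve 5 (λ u o v c w → (u ⊕ o ⊕ v ⊕ c) ⊕ w ⊜ (u ⊕ o ⊕ v) ⊕ c ⊕ w) refl
                    u (open⟨ a ⟩ ∷ []) v (close⟨ a ⟩ ∷ []) w
      where open MonoidSolver (++-monoid (Paren A))

  run⇒balanced : ∀ {w} → Run [] w [] → Balanced w
  run⇒balanced r with run-pending r (bottom bal-ε)
  ... | bottom b = b

  push-depth : ∀ n i → + suc n + i ≡ + n + (1ℤ + i)
  push-depth n = lemma (+ n)
    where
    lemma : ∀ m i → (1ℤ + m) + i ≡ m + (1ℤ + i)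
    lemma = solve-∀

  pop-depth : ∀ n i → + suc n + (-1ℤ + i) ≡ + n + i
  pop-depth n = lemma (+ n)
    where
    lemma : ∀ m i → (1ℤ + m) + (-1ℤ + i) ≡ m + i
    lemma = solve-∀

  run-height : ∀ {s w t} → Run s w t → + length t ≡ + length s + height w
  run-height {s} done                 = sym (ℤ.+-identityʳ (+ length s))
  run-height {s} (push {w = w} r)     = trans (run-height r) (push-depth (length s) (height w))
  run-height     (pop {s} {w = w} r)  = trans (run-height r) (sym (pop-depth (length s) (height w)))

  -- Reading v from p ++ s leaves a stack of depth length s + (+ length p + height v),
  -- so the hypothesis says that the bottom part s is never popped.
  run-unframe : ∀ p {s t} w → Run (p ++ s) w t →
                (∀ v → v ≼ w → 0ℤ ≤ᶻ + length p + height v) →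
                ∃ λ t′ → t ≡ t′ ++ s × Run p w t′
  run-unframe p []              done     _     = p , refl , done
  run-unframe p (open⟨ a ⟩ ∷ w) (push r) above with run-unframe (a ∷ p) w r (λ v v≼w →
    subst (0ℤ ≤ᶻ_) (sym (push-depth (length p) (height v))) (above (open⟨ a ⟩ ∷ v) (refl ∷ v≼w)))
  ... | t′ , t≡ , r′ = t′ , t≡ , push r′
  run-unframe [] (close⟨ a ⟩ ∷ w) _ above with above (close⟨ a ⟩ ∷ []) (refl ∷ [])
  ... | ()
  run-unframe (_ ∷ p) (close⟨ a ⟩ ∷ w) (pop r) above with run-unframe p w r (λ v v≼w →
    subst (0ℤ ≤ᶻ_) (pop-depth (length p) (height v)) (above (close⟨ a ⟩ ∷ v) (refl ∷ v≼w)))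
  ... | t′ , t≡ , r′ = t′ , t≡ , pop r′

  never-negative-run⇒balanced : ∀ {s w t} → Run s w t → NeverNegative w → height w ≡ 0ℤ → Balanced w
  never-negative-run⇒balanced {w = w} r w≥0 hw
    with run-unframe [] w r (λ v v≼w → subst (0ℤ ≤ᶻ_) (sym (ℤ.+-identityˡ (height v))) (w≥0 v v≼w))
  ... | t′ , _ , r′ = run⇒balanced (emptied t′ r′ (trans (run-height r′) (trans (ℤ.+-identityˡ _) hw)))
    where
    emptied : ∀ t → Run [] w t → + length t ≡ 0ℤ → Run [] w []
    emptied []      r _ = r
    emptied (_ ∷ _) _ ()

lemma55 : {ℓ : Level} {A : Set ℓ} (Q : List (Paren A)) →
    #open Q ≡ #close Q →
    (∃ λ (W : List (Paren A)) → Balanced W × (Q ++ Q) IsSubstringOf W) →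
    ∃ λ (i : ℕ) → i ≤ length Q × Balanced (drop i Q ++ take i Q)
lemma55 Q #Q (W , bW , Q²⊑W) with lowest-prefix Q
... | x , x-lowest@(x≼Q , _) with Prefix-as-∣ˡ x≼Q
... | record { quotient = y ; equality = refl }
    with balanced-substring-run bW (substring-trans (rotation-substring x y) Q²⊑W)
... | _ , _ , r = length x , length-++-≤ˡ x , subst Balanced (sym rotate) yx-balanced
  where
  hQ : height (x ++ y) ≡ 0ℤ
  hQ = begin
    height (x ++ y)                   ≡⟨ height≡#open⊖#close (x ++ y) ⟩
    #open (x ++ y) ⊖ #close (x ++ y)  ≡⟨ cong (_⊖ #close (x ++ y)) #Q ⟩
    #close (x ++ y) ⊖ #close (x ++ y) ≡⟨ ℤ.n⊖n≡0 (#close (x ++ y)) ⟩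
    0ℤ                                ∎
    where open ≡-Reasoning

  yx-balanced : Balanced (y ++ x)
  yx-balanced = never-negative-run⇒balanced r (lowest-rotation-never-negative x y x-lowest hQ)
                  (trans (height-rotate x y) hQ)

  rotate : drop (length x) (x ++ y) ++ take (length x) (x ++ y) ≡ y ++ x
  rotate = cong₂ _++_ (drop-length-++ x y) (take-length-++ x y)
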